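{- Let $(G,\mathcal{P})$ be a single-flow directed multipartite graph with two layers, $|V_1(G)|=a$ and $|V_2(G)|=b$. Then $\operatorname{Pic}(G)\cong\mathbb{Z}^b\times\mathbb{Z}_b^{\,a-1}$.
   Context: A single-flow directed multipartite graph with $t$ layers is a directed graph $G$ with a partition $V(G)=V_1(G)\sqcup\dots\sqcup V_t(G)$ into nonempty parts such that the arrows of $G$ are exactly one one-directional arrow $u\to v$ for each $i\in\{1,\dots,t-1\}$, $u\in V_i(G)$, $v\in V_{i+1}(G)$ (in particular no arrows within a part). The Laplacian $L_G$ of a directed graph on $v_1,\dots,v_n$ is the $n\times n$ integer matrix with $(i,i)$ entry the number of outgoing arrows of $v_i$ and $(i,j)$ entry ($i\ne j$) minus the number of arrows from $v_i$ to $v_j$. $\operatorname{Pic}(G)=\mathbb{Z}^n/L_G^T\mathbb{Z}^n$, $\mathbb{Z}_b=\mathbb{Z}/b\mathbb{Z}$. -}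

module Defs where

open import Data.Nat as ℕ using (ℕ; zero; suc)
open import Data.Integer as ℤ using (ℤ; +_; _-_; _*_)
import Data.Integer.Divisibility as ℤDiv
open import Data.Fin using (Fin; toℕ; _≟_) renaming (zero to fzero; suc to fsuc)
open import Data.Bool using (Bool; true; false)
open import Data.Product using (Σ; ∃; _×_; _,_)
open import Relation.Nullary using (Dec; yes; no; does)
open import Relation.Binary.PropositionalEquality using (_≡_)
import Data.Nat.Properties as ℕP
open import Data.Empty using (⊥)

sumℤ : ∀ {n} → (Fin n → ℤ) → ℤ
sumℤ {zero} f = + 0
sumℤ {suc n} f = f fzero ℤ.+ sumℤ (λ i → f (fsuc i))

sumℕ : ∀ {n} → (Fin n → ℕ) → ℕ
sumℕ {zero} f = 0
sumℕ {suc n} f = f fzero ℕ.+ sumℕ (λ i → f (fsuc i))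

count : ∀ {n} → (Fin n → Bool) → ℕ
count p = sumℕ (λ i → if′ (p i))
  where
  if′ : Bool → ℕ
  if′ true = 1
  if′ false = 0

-- A directed multigraph on the vertex set Fin n: arrows u v = number of arrows u → v.
Digraph : ℕ → Set
Digraph n = Fin n → Fin n → ℕ

-- Single-flow directed multipartite graph with t layers on vertices Fin n.
-- layer v = i means v ∈ V_{i+1}(G) (layers indexed from 0).
record SingleFlow (n t : ℕ) : Set where
  field
    graph    : Digraph n
    layer    : Fin n → Fin t
    nonempty : ∀ (i : Fin t) → ∃ λ v → layer v ≡ i
    flow-yes : ∀ u v → suc (toℕ (layer u)) ≡ toℕ (layer v) → graph u v ≡ 1
    flow-no  : ∀ u v → (suc (toℕ (layer u)) ≡ toℕ (layer v) → ⊥) → graph u v ≡ 0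

  partSize : Fin t → ℕ
  partSize i = count (λ v → does (layer v ≟ i))

laplacian : ∀ {n} → Digraph n → Fin n → Fin n → ℤ
laplacian {n} A i j with i ≟ j
... | yes _ = + sumℕ (A i)
... | no  _ = ℤ.- (+ A i j)

-- Equivalence on ℤ^n defining Pic(G) = ℤ^n / L_Gᵀ ℤ^n :
-- x ~ y iff x - y = L_Gᵀ z for some z ∈ ℤ^n.
PicRel : ∀ {n} → Digraph n → (Fin n → ℤ) → (Fin n → ℤ) → Set
PicRel {n} A x y = ∃ λ (z : Fin n → ℤ) →
  ∀ j → x j - y j ≡ sumℤ (λ i → laplacian A i j * z i)

-- The group ℤ^b × ℤ_b^c, represented on ℤ^b × ℤ^c with the equivalence
-- (equal on the first factor, congruent mod b on the second).
Target : ℕ → ℕ → Set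
Target b c = (Fin b → ℤ) × (Fin c → ℤ)

TargetRel : ∀ b c → Target b c → Target b c → Set
TargetRel b c (p , q) (p' , q') =
  (∀ k → p k ≡ p' k) × (∀ k → (+ b) ℤDiv.∣ (q k - q' k))

_+T_ : ∀ {b c} → Target b c → Target b c → Target b c
(p , q) +T (p' , q') = (λ k → p k ℤ.+ p' k) , (λ k → q k ℤ.+ q' k)

-- A group isomorphism Pic(G) ≅ ℤ^b × ℤ_b^c, expressed on representatives:
-- an additive map ℤ^n → ℤ^b × ℤ^c that is well defined, injective and
-- surjective modulo the respective equivalences.
record PicIso {n} (A : Digraph n) (b c : ℕ) : Set where
  field
    map        : (Fin n → ℤ) → Target b c
    additive   : ∀ x y → TargetRel b c (map (λ j → x j ℤ.+ y j)) (map x +T map y)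
    wellDef    : ∀ x y → PicRel A x y → TargetRel b c (map x) (map y)
    injective  : ∀ x y → TargetRel b c (map x) (map y) → PicRel A x y
    surjective : ∀ t → ∃ λ x → TargetRel b c (map x) t

-- Write b = |V₂| and enumerate V₁ = {u₀, …, u_{a−1}}, V₂ = {w₀, …, w_{b−1}}.
-- For z ∈ ℤⁿ the vector L_Gᵀz equals b·z on V₁ and is the constant −Σ_{V₁} z on
-- V₂. Hence d lies in the image of L_Gᵀ exactly when the b linear forms
-- Σ_{V₁} d + b·d(w₀) and d(w_m) − d(w₀) (m ≥ 1) vanish and b divides d(u_k) for
-- k ≥ 1: take z = d/b at u₁, …, u_{a−1} and choose z(u₀) so that −Σ_{V₁} z is
-- the common value of d on V₂. So x ↦ (those b forms, x(u_k) mod b for k ≥ 1)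
-- induces Pic(G) ≅ ℤ^b × ℤ_b^{a−1}; it is onto because x(u₀), x(w_m) (m ≥ 1)
-- and x(u_k) (k ≥ 1) can be prescribed independently.
module Submission where

open import Defs
open import Data.Nat using (ℕ; _∸_)
open import Data.Fin using (Fin; zero; suc; toℕ; _≟_)
open import Relation.Binary.PropositionalEquality
  using (_≡_; refl; sym; trans; cong; cong₂; subst; module ≡-Reasoning)

open import Data.Bool using (Bool; true; false; if_then_else_)
open import Data.Empty using (⊥-elim; ⊥-elim-irr)
import Data.Fin.Properties as Finₚ
open import Data.Integer using (ℤ; +_; -_; _+_; _-_; _*_)
import Data.Integer.Properties as ℤₚ
open import Algebra.Properties.AbelianGroup ℤₚ.+-0-abelianGroup
  using () renaming (inverseˡ-unique to +-inverseˡ-unique)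
open import Data.Integer.Divisibility using (_∣_)
import Data.Integer.Divisibility.Signed as Signed
open import Data.Integer.Tactic.RingSolver using (solve-∀)
import Data.Nat as ℕ
import Data.Nat.Divisibility as ℕ
import Data.Nat.Properties as ℕₚ
open import Data.Product using (∃; _×_; _,_; proj₁; proj₂)
open import Function using (_∘_; flip)
open import Relation.Nullary using (¬_; yes; no; does)
open import Relation.Nullary.Decidable using (dec-true; dec-false)

open ≡-Reasoning

true≢false : ¬ true ≡ false
true≢false ()

sumℕ-zero : ∀ {n} (f : Fin n → ℕ) → (∀ i → f i ≡ 0) → sumℕ f ≡ 0
sumℕ-zero {ℕ.zero}  f f≡0 = refl
sumℕ-zero {ℕ.suc n} f f≡0 = cong₂ ℕ._+_ (f≡0 zero) (sumℕ-zero (f ∘ suc) (f≡0 ∘ suc))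

sumℕ-count : ∀ {n} (p : Fin n → Bool) {f : Fin n → ℕ} →
             (∀ i → f i ≡ (if p i then 1 else 0)) → sumℕ f ≡ count p
sumℕ-count {ℕ.zero}  p f≡ = refl
-- count p only unfolds once p zero is a constructor, hence the identical clauses.
sumℕ-count {ℕ.suc n} p f≡ with p zero | f≡ zero
... | true  | f₀≡ = cong₂ ℕ._+_ f₀≡ (sumℕ-count (p ∘ suc) (f≡ ∘ suc))
... | false | f₀≡ = cong₂ ℕ._+_ f₀≡ (sumℕ-count (p ∘ suc) (f≡ ∘ suc))

sumℤ-cong : ∀ {n} {f g : Fin n → ℤ} → (∀ i → f i ≡ g i) → sumℤ f ≡ sumℤ g
sumℤ-cong {ℕ.zero}  f≡g = refl
sumℤ-cong {ℕ.suc n} f≡g = cong₂ _+_ (f≡g zero) (sumℤ-cong (f≡g ∘ suc))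

sumℤ-zero : ∀ {n} {f : Fin n → ℤ} → (∀ i → f i ≡ + 0) → sumℤ f ≡ + 0
sumℤ-zero {ℕ.zero}  f≡0 = refl
sumℤ-zero {ℕ.suc n} f≡0 = cong₂ _+_ (f≡0 zero) (sumℤ-zero (f≡0 ∘ suc))

sumℤ-single : ∀ {n} (f : Fin n → ℤ) j → (∀ i → ¬ i ≡ j → f i ≡ + 0) → sumℤ f ≡ f j
sumℤ-single f zero f≡0 = begin
  f zero + sumℤ (f ∘ suc) ≡⟨ cong (_+_ (f zero)) (sumℤ-zero f∘suc≡0) ⟩
  f zero + + 0            ≡⟨ ℤₚ.+-identityʳ (f zero) ⟩
  f zero                  ∎
  where
  f∘suc≡0 : ∀ i → f (suc i) ≡ + 0
  f∘suc≡0 i = f≡0 (suc i) (Finₚ.0≢1+n ∘ sym)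
sumℤ-single f (suc j) f≡0 = begin
  f zero + sumℤ (f ∘ suc)
    ≡⟨ cong₂ _+_ (f≡0 zero Finₚ.0≢1+n) (sumℤ-single (f ∘ suc) j f∘suc≡0) ⟩
  + 0 + f (suc j)
    ≡⟨ ℤₚ.+-identityˡ (f (suc j)) ⟩
  f (suc j)
    ∎
  where
  f∘suc≡0 : ∀ i → ¬ i ≡ j → f (suc i) ≡ + 0
  f∘suc≡0 i i≢j = f≡0 (suc i) (i≢j ∘ Finₚ.suc-injective)

sumℤ-distrib-+ : ∀ {n} (f g : Fin n → ℤ) → sumℤ (λ i → f i + g i) ≡ sumℤ f + sumℤ g
sumℤ-distrib-+ {ℕ.zero}  f g = refl
sumℤ-distrib-+ {ℕ.suc n} f g = begin
  (f zero + g zero) + sumℤ (λ i → f (suc i) + g (suc i))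
    ≡⟨ cong (_+_ (f zero + g zero)) (sumℤ-distrib-+ (f ∘ suc) (g ∘ suc)) ⟩
  (f zero + g zero) + (sumℤ (f ∘ suc) + sumℤ (g ∘ suc))
    ≡⟨ interchange (f zero) (g zero) (sumℤ (f ∘ suc)) (sumℤ (g ∘ suc)) ⟩
  (f zero + sumℤ (f ∘ suc)) + (g zero + sumℤ (g ∘ suc))
    ∎
  where
  interchange : ∀ a b c d → (a + b) + (c + d) ≡ (a + c) + (b + d)
  interchange = solve-∀

sumℤ-neg : ∀ {n} (f : Fin n → ℤ) → sumℤ (-_ ∘ f) ≡ - sumℤ f
sumℤ-neg {ℕ.zero}  f = refl
sumℤ-neg {ℕ.suc n} f = trans (cong (_+_ (- f zero)) (sumℤ-neg (f ∘ suc)))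
                             (sym (ℤₚ.neg-distrib-+ (f zero) (sumℤ (f ∘ suc))))

sumℤ-distrib-sub : ∀ {n} (f g : Fin n → ℤ) → sumℤ (λ i → f i - g i) ≡ sumℤ f - sumℤ g
sumℤ-distrib-sub f g = trans (sumℤ-distrib-+ f (-_ ∘ g)) (cong (_+_ (sumℤ f)) (sumℤ-neg g))

sumℤ-*ˡ : ∀ {n} c (f : Fin n → ℤ) → sumℤ (λ i → c * f i) ≡ c * sumℤ f
sumℤ-*ˡ {ℕ.zero}  c f = sym (ℤₚ.*-zeroʳ c)
sumℤ-*ˡ {ℕ.suc n} c f = trans (cong (_+_ (c * f zero)) (sumℤ-*ˡ c (f ∘ suc)))
                              (sym (ℤₚ.*-distribˡ-+ c (f zero) (sumℤ (f ∘ suc))))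

sumℤ-*ʳ : ∀ {n} (f : Fin n → ℤ) c → sumℤ (λ i → f i * c) ≡ sumℤ f * c
sumℤ-*ʳ f c = trans (sumℤ-cong (λ i → ℤₚ.*-comm (f i) c))
                    (trans (sumℤ-*ˡ c f) (ℤₚ.*-comm c (sumℤ f)))

sumOver : ∀ {n} → (Fin n → Bool) → (Fin n → ℤ) → ℤ
sumOver p f = sumℤ (λ v → if p v then f v else + 0)

-- Membership proofs are irrelevant, so index v does not depend on the proof
-- supplied; this is what lets extend compute on selected elements.
record Enumeration {n} (p : Fin n → Bool) (m : ℕ) : Set where
  field
    select         : Fin m → Fin n
    select-sat     : ∀ k → p (select k) ≡ true
    index          : ∀ v → .(p v ≡ true) → Fin m
    select-index   : ∀ v .(pv : p v ≡ true) → select (index v pv) ≡ v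
    index-select   : ∀ k → index (select k) (select-sat k) ≡ k
    sumOver-select : ∀ f → sumOver p f ≡ sumℤ (f ∘ select)

  select-elim : ∀ {P : Fin n → Set} → (∀ k → P (select k)) → ∀ v → p v ≡ true → P v
  select-elim {P} P-select v pv = subst P (select-index v pv) (P-select (index v pv))

  private
    extendAt : (Fin m → ℤ) → ∀ v b → .(p v ≡ b) → ℤ
    extendAt h v true  pv = h (index v pv)
    extendAt h v false _  = + 0

  extend : (Fin m → ℤ) → Fin n → ℤ
  extend h v = extendAt h v (p v) refl

  extend-select : ∀ h k → extend h (select k) ≡ h k
  extend-select h k = at (p (select k)) refl
    where
    at : ∀ b .(pk : p (select k) ≡ b) → extendAt h (select k) b pk ≡ h k
    at true  _  = cong h (index-select k)
    at false pk = ⊥-elim-irr (true≢false (trans (sym (select-sat k)) pk))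

  extend-outside : ∀ h v → p v ≡ false → extend h v ≡ + 0
  extend-outside h v pv = at (p v) refl pv
    where
    at : ∀ b .(r : p v ≡ b) → b ≡ false → extendAt h v b r ≡ + 0
    at false _ _ = refl

open Enumeration

module _ {n} {p : Fin (ℕ.suc n) → Bool} {m} (E : Enumeration (p ∘ suc) m) where

  enumeration-keep : p zero ≡ true → Enumeration p (ℕ.suc m)
  enumeration-keep p₀ .select zero          = zero
  enumeration-keep p₀ .select (suc k)       = suc (select E k)
  enumeration-keep p₀ .select-sat zero      = p₀
  enumeration-keep p₀ .select-sat (suc k)   = select-sat E k
  enumeration-keep p₀ .index zero _         = zero
  enumeration-keep p₀ .index (suc v) pv     = suc (index E v pv)
  enumeration-keep p₀ .select-index zero _  = refl
  enumeration-keep p₀ .select-index (suc v) pv = cong suc (select-index E v pv)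
  enumeration-keep p₀ .index-select zero    = refl
  enumeration-keep p₀ .index-select (suc k) = cong suc (index-select E k)
  enumeration-keep p₀ .sumOver-select f =
    cong₂ _+_ (cong (λ b → if b then f zero else + 0) p₀) (sumOver-select E (f ∘ suc))

  enumeration-skip : p zero ≡ false → Enumeration p m
  enumeration-skip p₀ .select                    = suc ∘ select E
  enumeration-skip p₀ .select-sat                = select-sat E
  enumeration-skip p₀ .index zero pv             = ⊥-elim-irr (true≢false (trans (sym pv) p₀))
  enumeration-skip p₀ .index (suc v) pv          = index E v pv
  enumeration-skip p₀ .select-index zero pv      = ⊥-elim-irr (true≢false (trans (sym pv) p₀))
  enumeration-skip p₀ .select-index (suc v) pv   = cong suc (select-index E v pv)
  enumeration-skip p₀ .index-select              = index-select E
  enumeration-skip p₀ .sumOver-select f = trans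
    (cong₂ _+_ (cong (λ b → if b then f zero else + 0) p₀) (sumOver-select E (f ∘ suc)))
    (ℤₚ.+-identityˡ _)

enumerate : ∀ {n} (p : Fin n → Bool) → Enumeration p (count p)
enumerate {ℕ.zero} p = record
  { select = λ () ; select-sat = λ () ; index = λ () ; select-index = λ ()
  ; index-select = λ () ; sumOver-select = λ _ → refl }
enumerate {ℕ.suc n} p with p zero in p₀
... | true  = enumeration-keep (enumerate (p ∘ suc)) p₀
... | false = enumeration-skip (enumerate (p ∘ suc)) p₀

laplacianᵀ : ∀ {n} → Digraph n → (Fin n → ℤ) → Fin n → ℤ
laplacianᵀ A z j = sumℤ (λ i → laplacian A i j * z i)

outdegree : ∀ {n} → Digraph n → Fin n → ℕ
outdegree A j = sumℕ (A j)

inflow : ∀ {n} → Digraph n → (Fin n → ℤ) → Fin n → ℤ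
inflow A z j = sumℤ (λ i → + A i j * z i)

module _ {n} (A : Digraph n) where

  laplacian-diagonal : ∀ j → laplacian A j j ≡ + outdegree A j
  laplacian-diagonal j with j ≟ j
  ... | yes _  = refl
  ... | no j≢j = ⊥-elim (j≢j refl)

  laplacian-offDiagonal : ∀ {i j} → ¬ i ≡ j → laplacian A i j ≡ - + A i j
  laplacian-offDiagonal {i} {j} i≢j with i ≟ j
  ... | yes i≡j = ⊥-elim (i≢j i≡j)
  ... | no _    = refl

  laplacianᵀ-loopless : ∀ z j → A j j ≡ 0 →
                        laplacianᵀ A z j ≡ + outdegree A j * z j - inflow A z j
  laplacianᵀ-loopless z j noLoop = begin
    laplacianᵀ A z j
      ≡⟨ sumℤ-cong (λ i → split (laplacian A i j) (+ A i j) (z i)) ⟩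
    sumℤ (λ i → degreePart i - + A i j * z i)
      ≡⟨ sumℤ-distrib-sub degreePart (λ i → + A i j * z i) ⟩
    sumℤ degreePart - inflow A z j
      ≡⟨ cong (_- inflow A z j) (sumℤ-single degreePart j offDiagonal) ⟩
    (laplacian A j j + + A j j) * z j - inflow A z j
      ≡⟨ cong (λ l → l * z j - inflow A z j) diagonal ⟩
    + outdegree A j * z j - inflow A z j
      ∎
    where
    degreePart : Fin n → ℤ
    degreePart i = (laplacian A i j + + A i j) * z i
    split : ∀ l a x → l * x ≡ (l + a) * x - a * x
    split = solve-∀
    offDiagonal : ∀ i → ¬ i ≡ j → degreePart i ≡ + 0
    offDiagonal i i≢j = begin
      (laplacian A i j + + A i j) * z i
        ≡⟨ cong (λ l → (l + + A i j) * z i) (laplacian-offDiagonal i≢j) ⟩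
      (- + A i j + + A i j) * z i
        ≡⟨ cong (_* z i) (ℤₚ.+-inverseˡ (+ A i j)) ⟩
      + 0 * z i
        ≡⟨ ℤₚ.*-zeroˡ (z i) ⟩
      + 0
        ∎
    diagonal : laplacian A j j + + A j j ≡ + outdegree A j
    diagonal = trans (cong₂ (λ l a → l + + a) (laplacian-diagonal j) noLoop) (ℤₚ.+-identityʳ _)

module Layers {n t} (G : SingleFlow n t) where
  open SingleFlow G

  inLayer : Fin t → Fin n → Bool
  inLayer i v = does (layer v ≟ i)

  inLayer⇒layer : ∀ {i v} → inLayer i v ≡ true → layer v ≡ i
  inLayer⇒layer {i} {v} inV with layer v ≟ i
  ... | yes lv = lv

  layer⇒inLayer : ∀ {i v} → layer v ≡ i → inLayer i v ≡ true
  layer⇒inLayer {i} {v} = dec-true (layer v ≟ i)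

  layer⇒¬inLayer : ∀ {i i′ v} → layer v ≡ i → ¬ i ≡ i′ → inLayer i′ v ≡ false
  layer⇒¬inLayer {i} {i′} {v} lv i≢i′ = dec-false (layer v ≟ i′) (i≢i′ ∘ trans (sym lv))

  partSize-nonzero : ∀ i → ¬ partSize i ≡ 0
  partSize-nonzero i size≡0 =
    Finₚ.¬Fin0 (subst Fin size≡0 (index (enumerate (inLayer i)) v (layer⇒inLayer lv)))
    where
    v : Fin n
    v = proj₁ (nonempty i)
    lv : layer v ≡ i
    lv = proj₂ (nonempty i)

  graph-loopless : ∀ v → graph v v ≡ 0
  graph-loopless v = flow-no v v ℕₚ.1+n≢n

module TwoLayers {n} (G : SingleFlow n 2) where
  open SingleFlow G
  open Layers G public

  V₁ V₂ : Fin n → Bool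
  V₁ = inLayer zero
  V₂ = inLayer (suc zero)

  arrow-V₁V₂ : ∀ {u v} → layer u ≡ zero → layer v ≡ suc zero → graph u v ≡ 1
  arrow-V₁V₂ {u} {v} lu lv = flow-yes u v (trans (cong (ℕ.suc ∘ toℕ) lu) (cong toℕ (sym lv)))

  arrow-into-V₁ : ∀ {u v} → layer v ≡ zero → graph u v ≡ 0
  arrow-into-V₁ {u} {v} lv = flow-no u v (ℕₚ.1+n≢0 ∘ flip trans (cong toℕ lv))

  arrow-from-V₂ : ∀ {u v} → layer u ≡ suc zero → graph u v ≡ 0
  arrow-from-V₂ {u} {v} lu = flow-no u v λ e →
    ℕₚ.<-irrefl (sym (trans (cong (ℕ.suc ∘ toℕ) (sym lu)) e)) (Finₚ.toℕ<n (layer v))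

  outdegree-V₁ : ∀ {u} → layer u ≡ zero → outdegree graph u ≡ partSize (suc zero)
  outdegree-V₁ {u} lu = sumℕ-count V₂ arrow
    where
    arrow : ∀ v → graph u v ≡ (if V₂ v then 1 else 0)
    arrow v with layer v in lv
    ... | zero     = arrow-into-V₁ lv
    ... | suc zero = arrow-V₁V₂ lu lv

  outdegree-V₂ : ∀ {u} → layer u ≡ suc zero → outdegree graph u ≡ 0
  outdegree-V₂ {u} lu = sumℕ-zero (graph u) (λ v → arrow-from-V₂ lu)

  inflow-V₁ : ∀ z {j} → layer j ≡ zero → inflow graph z j ≡ + 0
  inflow-V₁ z lj = sumℤ-zero λ i →
    trans (cong (λ a → + a * z i) (arrow-into-V₁ lj)) (ℤₚ.*-zeroˡ (z i))

  inflow-V₂ : ∀ z {j} → layer j ≡ suc zero → inflow graph z j ≡ sumOver V₁ z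
  inflow-V₂ z {j} lj = sumℤ-cong arrowsIn
    where
    arrowsIn : ∀ i → + graph i j * z i ≡ (if V₁ i then z i else + 0)
    arrowsIn i with layer i in li
    ... | zero     = trans (cong (λ a → + a * z i) (arrow-V₁V₂ li lj)) (ℤₚ.*-identityˡ (z i))
    ... | suc zero = trans (cong (λ a → + a * z i) (arrow-from-V₂ li)) (ℤₚ.*-zeroˡ (z i))

  laplacianᵀ-V₁ : ∀ z {j} → layer j ≡ zero → laplacianᵀ graph z j ≡ + partSize (suc zero) * z j
  laplacianᵀ-V₁ z {j} lj = begin
    laplacianᵀ graph z j
      ≡⟨ laplacianᵀ-loopless graph z j (graph-loopless j) ⟩
    + outdegree graph j * z j - inflow graph z j
      ≡⟨ cong₂ (λ d s → + d * z j - s) (outdegree-V₁ lj) (inflow-V₁ z lj) ⟩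
    + partSize (suc zero) * z j - + 0
      ≡⟨ ℤₚ.+-identityʳ _ ⟩
    + partSize (suc zero) * z j
      ∎

  laplacianᵀ-V₂ : ∀ z {j} → layer j ≡ suc zero → laplacianᵀ graph z j ≡ - sumOver V₁ z
  laplacianᵀ-V₂ z {j} lj = begin
    laplacianᵀ graph z j
      ≡⟨ laplacianᵀ-loopless graph z j (graph-loopless j) ⟩
    + outdegree graph j * z j - inflow graph z j
      ≡⟨ cong₂ (λ d s → + d * z j - s) (outdegree-V₂ lj) (inflow-V₂ z lj) ⟩
    + 0 * z j - sumOver V₁ z
      ≡⟨ cong (_- sumOver V₁ z) (ℤₚ.*-zeroˡ (z j)) ⟩
    + 0 - sumOver V₁ z
      ≡⟨ ℤₚ.+-identityˡ _ ⟩
    - sumOver V₁ z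
      ∎

module PicardGroup {n} (G : SingleFlow n 2) {a b}
    (E₁ : Enumeration (TwoLayers.V₁ G) (ℕ.suc a))
    (E₂ : Enumeration (TwoLayers.V₂ G) (ℕ.suc b))
    (|V₂|≡b : SingleFlow.partSize G (suc zero) ≡ ℕ.suc b) where
  open SingleFlow G
  open TwoLayers G

  β : ℤ
  β = + ℕ.suc b

  u : Fin (ℕ.suc a) → Fin n
  u = select E₁

  w : Fin (ℕ.suc b) → Fin n
  w = select E₂

  layer-u : ∀ k → layer (u k) ≡ zero
  layer-u k = inLayer⇒layer (select-sat E₁ k)

  layer-w : ∀ m → layer (w m) ≡ suc zero
  layer-w m = inLayer⇒layer (select-sat E₂ m)

  sumV₁ : (Fin n → ℤ) → ℤ
  sumV₁ x = sumℤ (x ∘ u)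

  free : (Fin n → ℤ) → Fin (ℕ.suc b) → ℤ
  free x zero    = sumV₁ x + β * x (w zero)
  free x (suc m) = x (w (suc m)) - x (w zero)

  torsion : (Fin n → ℤ) → Fin a → ℤ
  torsion x k = x (u (suc k))

  toTarget : (Fin n → ℤ) → Target (ℕ.suc b) a
  toTarget x = free x , torsion x

  Kernel : (Fin n → ℤ) → Set
  Kernel d = (∀ m → free d m ≡ + 0) × (∀ k → β ∣ torsion d k)

  laplacianᵀ-u : ∀ z k → laplacianᵀ graph z (u k) ≡ β * z (u k)
  laplacianᵀ-u z k = trans (laplacianᵀ-V₁ z (layer-u k)) (cong (λ s → + s * z (u k)) |V₂|≡b)

  laplacianᵀ-w : ∀ z m → laplacianᵀ graph z (w m) ≡ - sumV₁ z
  laplacianᵀ-w z m = trans (laplacianᵀ-V₂ z (layer-w m)) (cong -_ (sumOver-select E₁ z))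

  free-+ : ∀ x y m → free (λ j → x j + y j) m ≡ free x m + free y m
  free-+ x y zero = begin
    sumℤ (λ k → x (u k) + y (u k)) + β * (x (w zero) + y (w zero))
      ≡⟨ cong (_+ β * (x (w zero) + y (w zero))) (sumℤ-distrib-+ (x ∘ u) (y ∘ u)) ⟩
    (sumV₁ x + sumV₁ y) + β * (x (w zero) + y (w zero))
      ≡⟨ regroup (sumV₁ x) (sumV₁ y) β (x (w zero)) (y (w zero)) ⟩
    (sumV₁ x + β * x (w zero)) + (sumV₁ y + β * y (w zero))
      ∎
    where
    regroup : ∀ s t c p q → (s + t) + c * (p + q) ≡ (s + c * p) + (t + c * q)
    regroup = solve-∀
  free-+ x y (suc m) = regroup (x (w (suc m))) (y (w (suc m))) (x (w zero)) (y (w zero))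
    where
    regroup : ∀ p q p₀ q₀ → (p + q) - (p₀ + q₀) ≡ (p - p₀) + (q - q₀)
    regroup = solve-∀

  free-sub : ∀ x y m → free (λ j → x j - y j) m ≡ free x m - free y m
  free-sub x y zero = begin
    sumℤ (λ k → x (u k) - y (u k)) + β * (x (w zero) - y (w zero))
      ≡⟨ cong (_+ β * (x (w zero) - y (w zero))) (sumℤ-distrib-sub (x ∘ u) (y ∘ u)) ⟩
    (sumV₁ x - sumV₁ y) + β * (x (w zero) - y (w zero))
      ≡⟨ regroup (sumV₁ x) (sumV₁ y) β (x (w zero)) (y (w zero)) ⟩
    (sumV₁ x + β * x (w zero)) - (sumV₁ y + β * y (w zero))
      ∎
    where
    regroup : ∀ s t c p q → (s - t) + c * (p - q) ≡ (s + c * p) - (t + c * q)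
    regroup = solve-∀
  free-sub x y (suc m) = regroup (x (w (suc m))) (y (w (suc m))) (x (w zero)) (y (w zero))
    where
    regroup : ∀ p q p₀ q₀ → (p - q) - (p₀ - q₀) ≡ (p - p₀) - (q - q₀)
    regroup = solve-∀

  β∣β* : ∀ x → β ∣ β * x
  β∣β* x = Signed.∣⇒∣ᵤ (Signed.divides x (ℤₚ.*-comm β x))

  β∣x-x : ∀ x → β ∣ x - x
  β∣x-x x = subst (β ∣_) (sym (ℤₚ.+-inverseʳ x)) (ℕ.suc b ℕ.∣0)

  Kernel-cong : ∀ {d d′} → (∀ j → d j ≡ d′ j) → Kernel d′ → Kernel d
  Kernel-cong {d} {d′} d≡d′ (free≡0 , β∣torsion) =
      (λ m → trans (free-cong m) (free≡0 m))
    , (λ k → subst (β ∣_) (sym (d≡d′ (u (suc k)))) (β∣torsion k))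
    where
    free-cong : ∀ m → free d m ≡ free d′ m
    free-cong zero    = cong₂ (λ s c → s + β * c) (sumℤ-cong (d≡d′ ∘ u)) (d≡d′ (w zero))
    free-cong (suc m) = cong₂ _-_ (d≡d′ (w (suc m))) (d≡d′ (w zero))

  related⇒Kernel : ∀ x y → TargetRel (ℕ.suc b) a (toTarget x) (toTarget y) →
                   Kernel (λ j → x j - y j)
  related⇒Kernel x y (free≡ , β∣torsion) =
    (λ m → trans (free-sub x y m) (ℤₚ.i≡j⇒i-j≡0 (free≡ m))) , β∣torsion

  Kernel⇒related : ∀ x y → Kernel (λ j → x j - y j) →
                   TargetRel (ℕ.suc b) a (toTarget x) (toTarget y)
  Kernel⇒related x y (free≡0 , β∣torsion) =
    (λ m → ℤₚ.i-j≡0⇒i≡j _ _ (trans (sym (free-sub x y m)) (free≡0 m))) , β∣torsion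

  image⊆Kernel : ∀ z → Kernel (laplacianᵀ graph z)
  image⊆Kernel z =
    free≡0 , λ k → subst (β ∣_) (sym (laplacianᵀ-u z (suc k))) (β∣β* (z (u (suc k))))
    where
    free≡0 : ∀ m → free (laplacianᵀ graph z) m ≡ + 0
    free≡0 zero = begin
      sumℤ (laplacianᵀ graph z ∘ u) + β * laplacianᵀ graph z (w zero)
        ≡⟨ cong₂ (λ s c → s + β * c) (sumℤ-cong (laplacianᵀ-u z)) (laplacianᵀ-w z zero) ⟩
      sumℤ (λ k → β * z (u k)) + β * - sumV₁ z
        ≡⟨ cong (_+ β * - sumV₁ z) (sumℤ-*ˡ β (z ∘ u)) ⟩
      β * sumV₁ z + β * - sumV₁ z
        ≡⟨ cancel β (sumV₁ z) ⟩
      + 0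
        ∎
      where
      cancel : ∀ c s → c * s + c * - s ≡ + 0
      cancel = solve-∀
    free≡0 (suc m) = trans (cong₂ _-_ (laplacianᵀ-w z (suc m)) (laplacianᵀ-w z zero))
                           (ℤₚ.+-inverseʳ (- sumV₁ z))

  Kernel⊆image : ∀ d → Kernel d → ∃ λ z → ∀ j → d j ≡ laplacianᵀ graph z j
  Kernel⊆image d (free≡0 , β∣torsion) = z , d≡Lᵀz
    where
    q : Fin a → ℤ
    q k = Signed._∣_.quotient (Signed.∣ᵤ⇒∣ {β} {torsion d k} (β∣torsion k))
    d-u-suc : ∀ k → d (u (suc k)) ≡ q k * β
    d-u-suc k = Signed._∣_.equality (Signed.∣ᵤ⇒∣ {β} {torsion d k} (β∣torsion k))
    c : ℤ
    c = d (w zero)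
    h : Fin (ℕ.suc a) → ℤ
    h zero    = - c - sumℤ q
    h (suc k) = q k
    z : Fin n → ℤ
    z = extend E₁ h

    d-u : ∀ k → d (u k) ≡ β * z (u k)
    d-u (suc k) = begin
      d (u (suc k))      ≡⟨ d-u-suc k ⟩
      q k * β            ≡⟨ ℤₚ.*-comm (q k) β ⟩
      β * h (suc k)      ≡⟨ cong (β *_) (sym (extend-select E₁ h (suc k))) ⟩
      β * z (u (suc k))  ∎
    d-u zero = begin
      d (u zero)           ≡⟨ +-inverseˡ-unique (d (u zero)) (β * (sumℤ q + c)) free₀ ⟩
      - (β * (sumℤ q + c)) ≡⟨ regroup β (sumℤ q) c ⟩
      β * h zero           ≡⟨ cong (β *_) (sym (extend-select E₁ h zero)) ⟩
      β * z (u zero)       ∎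
      where
      regroup : ∀ c₁ s c₂ → - (c₁ * (s + c₂)) ≡ c₁ * (- c₂ - s)
      regroup = solve-∀
      expand : ∀ x s c₁ c₂ → x + c₁ * (s + c₂) ≡ (x + s * c₁) + c₁ * c₂
      expand = solve-∀
      free₀ : d (u zero) + β * (sumℤ q + c) ≡ + 0
      free₀ = begin
        d (u zero) + β * (sumℤ q + c)     ≡⟨ expand (d (u zero)) (sumℤ q) β c ⟩
        (d (u zero) + sumℤ q * β) + β * c ≡⟨ cong (λ s → (d (u zero) + s) + β * c) sum-d-u-suc ⟨
        free d zero                       ≡⟨ free≡0 zero ⟩
        + 0                               ∎
        where
        sum-d-u-suc : sumℤ (λ k → d (u (suc k))) ≡ sumℤ q * β
        sum-d-u-suc = trans (sumℤ-cong d-u-suc) (sumℤ-*ʳ q β)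

    c≡-sumV₁-z : c ≡ - sumV₁ z
    c≡-sumV₁-z = begin
      c                           ≡⟨ cancel c (sumℤ q) ⟩
      - ((- c - sumℤ q) + sumℤ q) ≡⟨ cong -_ (sumℤ-cong (extend-select E₁ h)) ⟨
      - sumV₁ z                   ∎
      where
      cancel : ∀ c s → c ≡ - ((- c - s) + s)
      cancel = solve-∀

    d-w : ∀ m → d (w m) ≡ - sumV₁ z
    d-w zero    = c≡-sumV₁-z
    d-w (suc m) = trans (ℤₚ.i-j≡0⇒i≡j _ _ (free≡0 (suc m))) c≡-sumV₁-z

    d≡Lᵀz : ∀ j → d j ≡ laplacianᵀ graph z j
    d≡Lᵀz j with layer j in lj
    ... | zero     = select-elim E₁ {λ v → d v ≡ laplacianᵀ graph z v}
                       (λ k → trans (d-u k) (sym (laplacianᵀ-u z k))) j (layer⇒inLayer lj)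
    ... | suc zero = select-elim E₂ {λ v → d v ≡ laplacianᵀ graph z v}
                       (λ m → trans (d-w m) (sym (laplacianᵀ-w z m))) j (layer⇒inLayer lj)

  toTarget-surjective : ∀ t → ∃ λ x → TargetRel (ℕ.suc b) a (toTarget x) t
  toTarget-surjective (p , r) =
    x , free-x , λ k → subst (λ e → β ∣ e - r k) (sym (x-u (suc k))) (β∣x-x (r k))
    where
    hu : Fin (ℕ.suc a) → ℤ
    hu zero    = p zero - sumℤ r
    hu (suc k) = r k
    hw : Fin (ℕ.suc b) → ℤ
    hw zero    = + 0
    hw (suc m) = p (suc m)
    x : Fin n → ℤ
    x j = extend E₁ hu j + extend E₂ hw j

    x-u : ∀ k → x (u k) ≡ hu k
    x-u k = trans (cong₂ _+_ (extend-select E₁ hu k) (extend-outside E₂ hw (u k) u∉V₂))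
                  (ℤₚ.+-identityʳ (hu k))
      where
      u∉V₂ : V₂ (u k) ≡ false
      u∉V₂ = layer⇒¬inLayer (layer-u k) Finₚ.0≢1+n
    x-w : ∀ m → x (w m) ≡ hw m
    x-w m = trans (cong₂ _+_ (extend-outside E₁ hu (w m) w∉V₁) (extend-select E₂ hw m))
                  (ℤₚ.+-identityˡ (hw m))
      where
      w∉V₁ : V₁ (w m) ≡ false
      w∉V₁ = layer⇒¬inLayer (layer-w m) (Finₚ.0≢1+n ∘ sym)

    free-x : ∀ m → free x m ≡ p m
    free-x zero = begin
      sumV₁ x + β * x (w zero)
        ≡⟨ cong₂ (λ s e → s + β * e) (sumℤ-cong x-u) (x-w zero) ⟩
      ((p zero - sumℤ r) + sumℤ r) + β * + 0
        ≡⟨ cancel (p zero) (sumℤ r) β ⟩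
      p zero
        ∎
      where
      cancel : ∀ p₀ s c₁ → ((p₀ - s) + s) + c₁ * + 0 ≡ p₀
      cancel = solve-∀
    free-x (suc m) = trans (cong₂ _-_ (x-w (suc m)) (x-w zero)) (ℤₚ.+-identityʳ (p (suc m)))

  picIso : PicIso graph (ℕ.suc b) a
  picIso = record
    { map        = toTarget
    ; additive   = λ x y → free-+ x y , λ k → β∣x-x (torsion x k + torsion y k)
    ; wellDef    = λ x y (z , x-y≡Lᵀz) →
                     Kernel⇒related x y (Kernel-cong x-y≡Lᵀz (image⊆Kernel z))
    ; injective  = λ x y related → Kernel⊆image _ (related⇒Kernel x y related)
    ; surjective = toTarget-surjective
    }

proposition6p3 : ∀ (n a b : ℕ) (G : SingleFlow n 2) →
                 SingleFlow.partSize G zero ≡ a →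
                 SingleFlow.partSize G (suc zero) ≡ b →
                 PicIso (SingleFlow.graph G) b (a ∸ 1)
proposition6p3 n ℕ.zero    b         G |V₁|≡a |V₂|≡b =
  ⊥-elim (Layers.partSize-nonzero G zero |V₁|≡a)
proposition6p3 n (ℕ.suc a) ℕ.zero    G |V₁|≡a |V₂|≡b =
  ⊥-elim (Layers.partSize-nonzero G (suc zero) |V₂|≡b)
proposition6p3 n (ℕ.suc a) (ℕ.suc b) G |V₁|≡a |V₂|≡b =
  PicardGroup.picIso G (subst (Enumeration _) |V₁|≡a (enumerate _))
                       (subst (Enumeration _) |V₂|≡b (enumerate _)) |V₂|≡b
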